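{- Let $G_{12}$ be the graph on vertex set $\{1,\dots,7\}$ with edges $12,13,14,16,23,26,27,34,35,36,37,45,56$, and let $G_{17}$ be the graph on vertex set $\{1,\dots,7\}$ with edges $12,13,14,15,16,23,24,26,27,34,45,47,56,57,67$. Then both $G_{12}$ and $G_{17}$ are permutationally $1$-$11$-representable.
   Context: For a word $w$ and letters $x,y$, let $w|_{\{x,y\}}$ be the subsequence of $w$ of all occurrences of $x$ and $y$. A word $w$ over $V$ $1$-$11$-represents a graph $G=(V,E)$ if for all distinct $x,y\in V$, the total number of occurrences of the factors $xx$ and $yy$ in $w|_{\{x,y\}}$ is at most $1$ if and only if $xy\in E$. $G$ is permutationally $1$-$11$-representable if it has such a representing word that is a concatenation of permutations of $V$ (words containing each vertex exactly once). -}

module Defs where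

open import Data.Nat using (ℕ; zero; suc; _+_; _≤_)
open import Data.Fin using (Fin; _≟_)
open import Data.Fin.Patterns
open import Data.List using (List; []; _∷_; filter; concat)
open import Data.List.Membership.Propositional using (_∈_)
open import Data.List.Relation.Unary.Unique.Propositional using (Unique)
open import Data.List.Relation.Unary.All using (All)
open import Data.Product using (_×_; _,_; ∃)
open import Data.Sum using (_⊎_)
open import Relation.Binary.PropositionalEquality using (_≡_; _≢_)
open import Relation.Nullary using (¬_)
open import Relation.Nullary.Decidable using (_⊎-dec_)
open import Function.Bundles using (_⇔_)

record Graph (n : ℕ) : Set where
  constructor graph
  field
    edges : List (Fin n × Fin n)

open Graph public

Adj : ∀ {n} → Graph n → Fin n → Fin n → Set
Adj G x y = ((x , y) ∈ edges G) ⊎ ((y , x) ∈ edges G)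

Word : ℕ → Set
Word n = List (Fin n)

restrict : ∀ {n} → Word n → Fin n → Fin n → Word n
restrict w x y = filter (λ z → (z ≟ x) ⊎-dec (z ≟ y)) w

-- Number of occurrences of factors of the form aa (a any letter), i.e. the
-- number of positions i with u_i = u_{i+1}. Applied to w|_{x,y}, this is
-- the total number of occurrences of the factors xx and yy.
sqAfter : ∀ {n} → Fin n → Word n → ℕ
sqAfter a [] = 0
sqAfter a (b ∷ u) with a ≟ b
... | Relation.Nullary.yes _ = suc (sqAfter b u)
... | Relation.Nullary.no  _ = sqAfter b u

countSquares : ∀ {n} → Word n → ℕ
countSquares [] = 0
countSquares (a ∷ u) = sqAfter a u

Represents111 : ∀ {n} → Graph n → Word n → Set
Represents111 {n} G w =
  (x y : Fin n) → x ≢ y → (countSquares (restrict w x y) ≤ 1 ⇔ Adj G x y)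

IsPermutation : ∀ {n} → Word n → Set
IsPermutation {n} p = Unique p × ((v : Fin n) → v ∈ p)

PermRepresentable111 : ∀ {n} → Graph n → Set
PermRepresentable111 {n} G =
  ∃ λ (ps : List (Word n)) → All IsPermutation ps × Represents111 G (concat ps)

-- Vertices 1..7 of the paper are encoded as 0..6 in Fin 7.
G12 : Graph 7
G12 = graph
  ( (0F , 1F) ∷ (0F , 2F) ∷ (0F , 3F) ∷ (0F , 5F) ∷ (1F , 2F) ∷ (1F , 5F)
  ∷ (1F , 6F) ∷ (2F , 3F) ∷ (2F , 4F) ∷ (2F , 5F) ∷ (2F , 6F) ∷ (3F , 4F)
  ∷ (4F , 5F) ∷ [] )

G17 : Graph 7
G17 = graph
  ( (0F , 1F) ∷ (0F , 2F) ∷ (0F , 3F) ∷ (0F , 4F) ∷ (0F , 5F) ∷ (1F , 2F)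
  ∷ (1F , 3F) ∷ (1F , 5F) ∷ (1F , 6F) ∷ (2F , 3F) ∷ (3F , 4F) ∷ (3F , 6F)
  ∷ (4F , 5F) ∷ (4F , 6F) ∷ (5F , 6F) ∷ [] )

-- Both graphs are witnessed by explicit concatenations of three permutations;
-- since every notion involved is decidable, checking a candidate word is a
-- finite computation carried out by the type checker.
module Submission where

open import Defs
open import Data.Nat using (ℕ; _≤?_)
open import Data.Fin using (Fin; _≟_)
open import Data.Fin.Patterns
open import Data.Fin.Properties using (all?)
open import Data.List using (List; []; _∷_; concat)
open import Data.List.Relation.Unary.All as All using (All)
open import Data.List.Relation.Unary.AllPairs using (allPairs?)
open import Data.List.Membership.DecPropositional using (_∈?_)
open import Data.Product using (_×_; _,_; uncurry)
open import Data.Product.Properties using (≡-dec)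
open import Function.Bundles using (_⇔_; mk⇔; Equivalence)
open import Relation.Nullary using (Dec; ¬?)
open import Relation.Nullary.Decidable using (True; toWitness; map′; _×-dec_; _⊎-dec_; _→-dec_)

infix 2 _⇔-dec_

_⇔-dec_ : ∀ {a b} {A : Set a} {B : Set b} → Dec A → Dec B → Dec (A ⇔ B)
a? ⇔-dec b? = map′ (uncurry mk⇔) (λ e → Equivalence.to e , Equivalence.from e)
                   ((a? →-dec b?) ×-dec (b? →-dec a?))

adj? : ∀ {n} (G : Graph n) (x y : Fin n) → Dec (Adj G x y)
adj? G x y = (_∈?_ (≡-dec _≟_ _≟_) (x , y) (edges G))
      ⊎-dec (_∈?_ (≡-dec _≟_ _≟_) (y , x) (edges G))

represents111? : ∀ {n} (G : Graph n) (w : Word n) → Dec (Represents111 G w)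
represents111? G w = all? λ x → all? λ y →
  ¬? (x ≟ y) →-dec (countSquares (restrict w x y) ≤? 1 ⇔-dec adj? G x y)

isPermutation? : ∀ {n} (p : Word n) → Dec (IsPermutation p)
isPermutation? p = allPairs? (λ x y → ¬? (x ≟ y)) p ×-dec all? (λ v → _∈?_ _≟_ v p)

permRepresentable111-by : ∀ {n} (G : Graph n) (ps : List (Word n)) →
  {True (All.all? isPermutation? ps)} → {True (represents111? G (concat ps))} →
  PermRepresentable111 G
permRepresentable111-by G ps {perms} {rep} = ps , toWitness perms , toWitness rep

G12-permutations : List (Word 7)
G12-permutations =
    (3F ∷ 5F ∷ 4F ∷ 0F ∷ 1F ∷ 6F ∷ 2F ∷ [])
  ∷ (6F ∷ 5F ∷ 0F ∷ 1F ∷ 3F ∷ 4F ∷ 2F ∷ [])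
  ∷ (2F ∷ 4F ∷ 0F ∷ 3F ∷ 5F ∷ 6F ∷ 1F ∷ []) ∷ []

G17-permutations : List (Word 7)
G17-permutations =
    (6F ∷ 5F ∷ 3F ∷ 4F ∷ 2F ∷ 1F ∷ 0F ∷ [])
  ∷ (2F ∷ 0F ∷ 6F ∷ 1F ∷ 3F ∷ 4F ∷ 5F ∷ [])
  ∷ (6F ∷ 0F ∷ 4F ∷ 1F ∷ 5F ∷ 2F ∷ 3F ∷ []) ∷ []

mainTheorem9 : PermRepresentable111 G12 × PermRepresentable111 G17
mainTheorem9 = permRepresentable111-by G12 G12-permutations
             , permRepresentable111-by G17 G17-permutations
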